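{- Let $n\geq 2k+1$ and $x\in X_{n,k}$. For any subword $y$ of $\widehat{x}$ that starts and ends at height $0$ and has the form $y=1u0$ with $u\in D$, the first and the last step of $y$ belong to the same glider $\gamma\in\Gamma(y)$, and $\gamma$ has the maximum speed among all gliders in $\Gamma(y)$.
   Context: Let $k\geq1$, $n\geq 2k+1$, and $X_{n,k}$ be the set of binary strings of length $n$ with exactly $k$ ones, indices taken cyclically. Parenthesis matching: regarding $x$ cyclically, each $1$ is matched to the last $0$ of the shortest cyclic substring starting at this $1$ and going rightwards that contains equally many $0$s and $1$s; every $1$ is matched, and $n-2k$ zeros are unmatched. Let $\widehat{x}$ be the bi-infinite string with $\widehat{x}_i=x_{i \bmod n}$ for $i\in\mathbb{Z}$, with matched/unmatched status inherited, viewed as a lattice path: matched $1$ = up-step, matched $0$ = down-step, unmatched $0$ = flat step, heights normalized so flat steps lie at height $0$. Let $D$ be the set of Dyck words, $\varepsilon$ the empty word, $D'=\{1u0:u\in D\}$, and $\overline{z}$ the bitwise complement of $z$. Every $y\in D'$ of height $h$ decomposes uniquely as $y=10$ if $h=1$, and otherwise as $y=1u_1\,1u_2\cdots 1u_{h-2}\,1\,1\,v_0\,0\,v_1\,0\cdots 0\,v_{h-2}\,0\,0$ with $u_i\in D$, $\overline{v_i}\in D$. For a word $y$ occupying consecutive positions of $\mathbb{Z}$ (positions retained): $\Gamma(\varepsilon)=\emptyset$; if $y\in D\setminus(D'\cup\{\varepsilon\})$, $y=y_1\cdots y_\ell$ with $y_i\in D'$, then $\Gamma(y)=\bigcup_i\Gamma(y_i)$;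 if $y\in D'$, $\Gamma(y)=\bigcup_{i=1}^{h-2}\Gamma(u_i)\cup\bigcup_{i=0}^{h-2}\Gamma(\overline{v_i})\cup\{(A,B)\}$, where $\overline{v_i}$ is the complemented word occupying the same positions as $v_i$, $A$ is the set of positions of the $1$s of $y$ not in any $u_i$ or $v_i$, and $B$ the set of positions of the $0$s of $y$ not in any $u_i$ or $v_i$. Elements of these sets are gliders; a step at position $j$ belongs to glider $(A,B)$ if $j\in A\cup B$. The speed of $(A,B)$ is $|A|=|B|$. -}

module Defs where

open import Data.Bool using (Bool; true; false; not; T; if_then_else_)
open import Data.Nat as ℕ using (ℕ; zero; suc; _⊔_; NonZero)
open import Data.Integer as ℤ using (ℤ; +_; _+_; _-_)
open import Data.List using (List; []; _∷_; _++_; length; map; [_])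
open import Data.Vec using (Vec; lookup)
import Data.Vec as V
open import Data.Product using (_×_; _,_; Σ)
open import Relation.Binary.PropositionalEquality using (_≡_; _≢_)
open import Data.Integer.DivMod using (_%ℕ_)
open import Data.Nat.DivMod using (_mod_)

-- Binary strings: true = 1, false = 0.

ones : ∀ {n} → Vec Bool n → ℕ
ones V.[] = 0
ones (true V.∷ x) = suc (ones x)
ones (false V.∷ x) = ones x

xhat : ∀ {n} .{{_ : NonZero n}} → Vec Bool n → ℤ → Bool
xhat {n} x i = lookup x ((i %ℕ n) mod n)

window : (ℤ → Bool) → ℤ → ℕ → List Bool
window f i zero = []
window f i (suc L) = f i ∷ window f (i + + 1) L

sgn : Bool → ℤ
sgn true = + 1
sgn false = ℤ.-[1+ 0 ]

balance : (ℤ → Bool) → ℤ → ℕ → ℤ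
balance f p zero = + 0
balance f p (suc l) = sgn (f p) + balance f (p + + 1) l

-- the 1 at position p is matched with the 0 at position p + len − 1:
-- len is the length of the shortest substring starting at p (going
-- right) with equally many 0s and 1s
Matches : (ℤ → Bool) → ℤ → ℕ → Set
Matches f p len =
  f p ≡ true × (1 ℕ.≤ len) × balance f p len ≡ + 0 ×
  (∀ l → 1 ℕ.≤ l → l ℕ.< len → balance f p l ≢ + 0)

MatchedZero : (ℤ → Bool) → ℤ → Set
MatchedZero f j = f j ≡ false × Σ ℤ λ p → Σ ℕ λ len → Matches f p len × (p + + len) - + 1 ≡ j

Unmatched : (ℤ → Bool) → ℤ → Set
Unmatched f j = f j ≡ false × (∀ p len → Matches f p len → (p + + len) - + 1 ≢ j)

-- H is the height function of the lattice path of f: H j is the height at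
-- the boundary just before step j; matched 1 = up-step, matched 0 =
-- down-step, unmatched 0 = flat step, flat steps lie at height 0.
IsHeight : (ℤ → Bool) → (ℤ → ℤ) → Set
IsHeight f H =
  (∀ j → f j ≡ true → H (j + + 1) ≡ H j + + 1) ×
  (∀ j → MatchedZero f j → H (j + + 1) ≡ H j - + 1) ×
  (∀ j → Unmatched f j → H j ≡ + 0 × H (j + + 1) ≡ + 0)

dyckAux : ℕ → List Bool → Bool
dyckAux zero [] = true
dyckAux (suc h) [] = false
dyckAux h (true ∷ w) = dyckAux (suc h) w
dyckAux zero (false ∷ w) = false
dyckAux (suc h) (false ∷ w) = dyckAux h w

IsDyck : List Bool → Set
IsDyck w = T (dyckAux 0 w)

IsD' : List Bool → Set
IsD' y = Σ (List Bool) λ u → IsDyck u × y ≡ true ∷ (u ++ [ false ])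

peak : ℕ → List Bool → ℕ
peak h [] = h
peak h (true ∷ w) = h ⊔ peak (suc h) w
peak h (false ∷ w) = h ⊔ peak (ℕ.pred h) w

height : List Bool → ℕ
height = peak 0

-- Gliders: (A , B), A = positions of its 1s, B = positions of its 0s

Glider : Set
Glider = List ℤ × List ℤ

speed : Glider → ℕ
speed (A , B) = length A

stepsOf : Glider → List ℤ
stepsOf (A , B) = A ++ B

len : List Bool → ℤ
len w = + length w

-- Γ as a relation: IsΓ s y G  means  "G lists the gliders of Γ(y), where the
-- word y occupies positions s, s+1, …" (for some admissible choice of the
-- decompositions used in the definition).
data IsΓ : ℤ → List Bool → List Glider → Set
data IsΓD' : ℤ → List Bool → List Glider → Set
-- USec s w A G : w = 1u₁ 1u₂ ⋯ 1uₘ (uᵢ ∈ D), A = positions of the displayed 1s,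
--               G = ⋃ Γ(uᵢ)
data USec : ℤ → List Bool → List ℤ → List Glider → Set
-- VSec s w B G : w = v₀0 v₁0 ⋯ vₘ0 (v̄ᵢ ∈ D), B = positions of the displayed 0s,
--               G = ⋃ Γ(v̄ᵢ)
data VSec : ℤ → List Bool → List ℤ → List Glider → Set

data IsΓ where
  Γε   : ∀ {s} → IsΓ s [] []
  Γcat : ∀ {s y₁ rest G₁ G₂} → IsD' y₁ → IsΓD' s y₁ G₁ →
         IsΓ (s + len y₁) rest G₂ → IsΓ s (y₁ ++ rest) (G₁ ++ G₂)

data USec where
  uNil  : ∀ {s} → USec s [] [] []
  uCons : ∀ {s u w A G G'} → IsDyck u → IsΓ (s + + 1) u G →
          USec ((s + + 1) + len u) w A G' →
          USec s (true ∷ (u ++ w)) (s ∷ A) (G ++ G')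

data VSec where
  vNil  : ∀ {s} → VSec s [] [] []
  vCons : ∀ {s v w B G G'} → IsDyck (map not v) → IsΓ s (map not v) G →
          VSec ((s + len v) + + 1) w B G' →
          VSec s (v ++ (false ∷ w)) ((s + len v) ∷ B) (G ++ G')

data IsΓD' where
  d10  : ∀ {s} → IsΓD' s (true ∷ false ∷ []) [ (s ∷ [] , (s + + 1) ∷ []) ]
  -- height h = m + 2 ≥ 2:
  -- y = 1u₁ ⋯ 1uₘ 1 1 v₀ 0 v₁ 0 ⋯ 0 vₘ 0 0
  dBig : ∀ {s w₁ w₂ A B G₁ G₂} →
         USec s w₁ A G₁ →
         VSec ((s + len w₁) + + 2) w₂ B G₂ →
         length B ≡ suc (length A) →
         IsD' (w₁ ++ (true ∷ true ∷ (w₂ ++ [ false ]))) →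
         height (w₁ ++ (true ∷ true ∷ (w₂ ++ [ false ]))) ≡ 2 ℕ.+ length A →
         IsΓD' s (w₁ ++ (true ∷ true ∷ (w₂ ++ [ false ])))
           (G₁ ++ (G₂ ++ [ ( A ++ ((s + len w₁) ∷ ((s + len w₁) + + 1) ∷ [])
                           , B ++ [ (s + len (w₁ ++ (true ∷ true ∷ (w₂ ++ [ false ])))) - + 1 ] ) ]))

{-# OPTIONS --safe #-}
-- A word y ∈ D' of height h carries the outer glider (A , B) of its
-- decomposition, whose speed is (h − 2) + 2 = h and which contains both the
-- first step of y (the leading 1) and the last one (the trailing 0).
-- Conversely every glider of Γ(y) has speed at most height y: the uᵢ are
-- read one level higher inside y, and a complemented vᵢ rises at most as
-- far as vᵢ descends, which is bounded by the height at which vᵢ starts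
-- because y never goes below 0.
module Submission where

open import Defs
open import Data.Bool using (Bool; true; false; not; T)
open import Data.Nat using (ℕ; _≤_; _*_; NonZero; zero; suc; z≤n; s≤s; _⊔_; pred)
open import Data.Nat using () renaming (_+_ to _+ℕ_)
open import Data.Nat.Properties
  using (≤-refl; ≤-trans; ≤-reflexive; m≤m⊔n; m≤n⊔m; ⊔-mono-≤; ⊔-lub; m≤m+n; +-suc; +-comm; +-identityʳ; pred-mono-≤)
open import Data.Integer using (ℤ; +_; -[1+_]; _+_; _-_)
import Data.Integer.Properties as ℤ
open import Data.List using (List; []; _∷_; _++_; length; map; [_])
open import Data.List.Properties using (++-assoc; length-++)
open import Data.List.Membership.Propositional using (_∈_)
open import Data.List.Membership.Propositional.Properties using (∈-++⁻; ∈-++⁺ˡ; ∈-++⁺ʳ)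
open import Data.List.Relation.Unary.Any using (here; there)
open import Data.Vec using (Vec)
open import Data.Product using (_×_; Σ; _,_)
open import Data.Sum using (inj₁; inj₂)
open import Relation.Binary.PropositionalEquality using (_≡_; refl; sym; trans; subst; cong)
open Relation.Binary.PropositionalEquality.≡-Reasoning

-- Like peak, this truncates at 0 (pred 0 = 0).
endHeight : ℕ → List Bool → ℕ
endHeight h [] = h
endHeight h (true ∷ w) = endHeight (suc h) w
endHeight h (false ∷ w) = endHeight (pred h) w

peak-≥-start : ∀ h w → h ≤ peak h w
peak-≥-start h [] = ≤-refl
peak-≥-start h (true ∷ w) = m≤m⊔n h _
peak-≥-start h (false ∷ w) = m≤m⊔n h _

peak-mono : ∀ {h h'} → h ≤ h' → ∀ w → peak h w ≤ peak h' w
peak-mono h≤h' [] = h≤h'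
peak-mono h≤h' (true ∷ w) = ⊔-mono-≤ h≤h' (peak-mono (s≤s h≤h') w)
peak-mono h≤h' (false ∷ w) = ⊔-mono-≤ h≤h' (peak-mono (pred-mono-≤ h≤h') w)

peak-++ˡ : ∀ h a b → peak h a ≤ peak h (a ++ b)
peak-++ˡ h [] b = peak-≥-start h b
peak-++ˡ h (true ∷ a) b = ⊔-mono-≤ (≤-refl {h}) (peak-++ˡ (suc h) a b)
peak-++ˡ h (false ∷ a) b = ⊔-mono-≤ (≤-refl {h}) (peak-++ˡ (pred h) a b)

peak-++ʳ : ∀ h a b → peak (endHeight h a) b ≤ peak h (a ++ b)
peak-++ʳ h [] b = ≤-refl
peak-++ʳ h (true ∷ a) b = ≤-trans (peak-++ʳ (suc h) a b) (m≤n⊔m h _)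
peak-++ʳ h (false ∷ a) b = ≤-trans (peak-++ʳ (pred h) a b) (m≤n⊔m h _)

dyckAux-true : ∀ h w → dyckAux h (true ∷ w) ≡ dyckAux (suc h) w
dyckAux-true zero w = refl
dyckAux-true (suc h) w = refl

dyckAux-suffix : ∀ h a b → T (dyckAux h (a ++ b)) → T (dyckAux (endHeight h a) b)
dyckAux-suffix h [] b d = d
dyckAux-suffix h (true ∷ a) b d = dyckAux-suffix (suc h) a b (subst T (dyckAux-true h (a ++ b)) d)
dyckAux-suffix zero (false ∷ a) b ()
dyckAux-suffix (suc h) (false ∷ a) b d = dyckAux-suffix h a b d

dyckAux-++ : ∀ c h u r → T (dyckAux h u) → dyckAux (c +ℕ h) (u ++ r) ≡ dyckAux c r
dyckAux-++ c zero [] r _ = cong (λ m → dyckAux m r) (+-identityʳ c)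
dyckAux-++ c (suc h) [] r ()
dyckAux-++ c h (true ∷ u) r d = begin
  dyckAux (c +ℕ h) (true ∷ u ++ r)   ≡⟨ dyckAux-true (c +ℕ h) (u ++ r) ⟩
  dyckAux (suc (c +ℕ h)) (u ++ r)    ≡⟨ cong (λ m → dyckAux m (u ++ r)) (sym (+-suc c h)) ⟩
  dyckAux (c +ℕ suc h) (u ++ r)      ≡⟨ dyckAux-++ c (suc h) u r (subst T (dyckAux-true h u) d) ⟩
  dyckAux c r                        ∎
dyckAux-++ c zero (false ∷ u) r ()
dyckAux-++ c (suc h) (false ∷ u) r d =
  trans (cong (λ m → dyckAux m (false ∷ u ++ r)) (+-suc c h)) (dyckAux-++ c h u r d)

IsD'⇒IsDyck : ∀ {y} → IsD' y → IsDyck y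
IsD'⇒IsDyck (u , u∈D , refl) = subst T (sym (dyckAux-++ 1 0 u [ false ] u∈D)) _

-- Read from height d, the complement of v rises at most as far as v, read
-- from height h inside a Dyck path, can descend, i.e. by at most h.
peak-complement : ∀ d h v q → T (dyckAux d (map not v)) → T (dyckAux h (v ++ q)) →
                  peak d (map not v) ≤ d +ℕ h
peak-complement d h [] q _ _ = m≤m+n d h
peak-complement zero h (true ∷ v) q () _
peak-complement (suc d) h (true ∷ v) q v̄∈D vq∈D = ⊔-lub (m≤m+n (suc d) h)
  (subst (peak d (map not v) ≤_) (+-suc d h)
    (peak-complement d (suc h) v q v̄∈D (subst T (dyckAux-true h (v ++ q)) vq∈D)))
peak-complement d zero (false ∷ v) q _ ()
peak-complement d (suc h) (false ∷ v) q v̄∈D vq∈D = ⊔-lub (m≤m+n d (suc h))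
  (subst (peak (suc d) (map not v) ≤_) (sym (+-suc d h))
    (peak-complement (suc d) h v q (subst T (dyckAux-true d (map not v)) v̄∈D) vq∈D))

speed≤height : ∀ {s w G} → IsΓ s w G → ∀ {γ} → γ ∈ G → speed γ ≤ height w
speed≤height-D' : ∀ {s y G} → IsΓD' s y G → ∀ {γ} → γ ∈ G → speed γ ≤ height y
speed≤peak-USec : ∀ {s w A G} → USec s w A G → ∀ h post {γ} → γ ∈ G → speed γ ≤ peak h (w ++ post)
speed≤peak-VSec : ∀ {s w B G} → VSec s w B G → ∀ h post → T (dyckAux h (w ++ post)) →
                  ∀ {γ} → γ ∈ G → speed γ ≤ peak h (w ++ post)

speed≤height Γε ()
speed≤height (Γcat {y₁ = y₁} {rest} {G₁ = G₁} _ Γy₁ Γrest) γ∈G with ∈-++⁻ G₁ γ∈G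
... | inj₁ γ∈G₁ = ≤-trans (speed≤height-D' Γy₁ γ∈G₁) (peak-++ˡ 0 y₁ rest)
... | inj₂ γ∈G₂ = ≤-trans (speed≤height Γrest γ∈G₂)
                    (≤-trans (peak-mono z≤n rest) (peak-++ʳ 0 y₁ rest))

speed≤peak-USec uNil h post ()
speed≤peak-USec (uCons {u = u} {w} {G = G} _ Γu sec) h post {γ} γ∈G =
  subst (λ z → speed γ ≤ h ⊔ peak (suc h) z) (sym (++-assoc u w post)) (≤-trans bound (m≤n⊔m h _))
  where
  bound : speed γ ≤ peak (suc h) (u ++ (w ++ post))
  bound with ∈-++⁻ G γ∈G
  ... | inj₁ γ∈Gu = ≤-trans (speed≤height Γu γ∈Gu)
                      (≤-trans (peak-mono z≤n u) (peak-++ˡ (suc h) u (w ++ post)))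
  ... | inj₂ γ∈G' = ≤-trans (speed≤peak-USec sec (endHeight (suc h) u) post γ∈G')
                      (peak-++ʳ (suc h) u (w ++ post))

speed≤peak-VSec vNil h post _ ()
speed≤peak-VSec (vCons {v = v} {w} {G = G} v̄∈D Γv̄ sec) h post path∈D {γ} γ∈G =
  subst (λ z → speed γ ≤ peak h z) (sym regroup) bound
  where
  v0 = v ++ [ false ]
  regroup : (v ++ false ∷ w) ++ post ≡ v0 ++ (w ++ post)
  regroup = trans (++-assoc v (false ∷ w) post) (sym (++-assoc v [ false ] (w ++ post)))
  v0-path∈D : T (dyckAux h (v0 ++ (w ++ post)))
  v0-path∈D = subst (λ z → T (dyckAux h z)) regroup path∈D
  bound : speed γ ≤ peak h (v0 ++ (w ++ post))
  bound with ∈-++⁻ G γ∈G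
  ... | inj₁ γ∈Gv = ≤-trans (speed≤height Γv̄ γ∈Gv)
                      (≤-trans (peak-complement 0 h v _ v̄∈D
                                  (subst (λ z → T (dyckAux h z)) (++-assoc v [ false ] (w ++ post)) v0-path∈D))
                               (peak-≥-start h (v0 ++ (w ++ post))))
  ... | inj₂ γ∈G' = ≤-trans (speed≤peak-VSec sec (endHeight h v0) post
                               (dyckAux-suffix h v0 (w ++ post) v0-path∈D) γ∈G')
                      (peak-++ʳ h v0 (w ++ post))

outerSpeed : ∀ {m} (A : List ℤ) {a b : ℤ} → m ≡ 2 +ℕ length A → m ≡ length (A ++ a ∷ b ∷ [])
outerSpeed A refl = trans (+-comm 2 (length A)) (sym (length-++ A))

speed≤height-D' d10 (here refl) = ≤-refl
speed≤height-D' d10 (there ())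
speed≤height-D' (dBig {w₁ = w₁} {w₂} {A} {G₁ = G₁} {G₂} secU secV _ y∈D' h≡) {γ} γ∈G with ∈-++⁻ G₁ γ∈G
... | inj₁ γ∈G₁ = speed≤peak-USec secU 0 (true ∷ true ∷ (w₂ ++ [ false ])) γ∈G₁
... | inj₂ γ∈G' with ∈-++⁻ G₂ γ∈G'
...   | inj₁ γ∈G₂ = subst (λ z → speed γ ≤ peak 0 z) regroup
          (≤-trans (speed≤peak-VSec secV (endHeight 0 w₁11) [ false ] suffix∈D γ∈G₂)
                   (peak-++ʳ 0 w₁11 (w₂ ++ [ false ])))
  where
  w₁11 = w₁ ++ true ∷ true ∷ []
  regroup : w₁11 ++ (w₂ ++ [ false ]) ≡ w₁ ++ (true ∷ true ∷ (w₂ ++ [ false ]))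
  regroup = ++-assoc w₁ (true ∷ true ∷ []) (w₂ ++ [ false ])
  suffix∈D : T (dyckAux (endHeight 0 w₁11) (w₂ ++ [ false ]))
  suffix∈D = dyckAux-suffix 0 w₁11 (w₂ ++ [ false ])
               (subst (λ z → T (dyckAux 0 z)) (sym regroup) (IsD'⇒IsDyck y∈D'))
...   | inj₂ (here refl) = ≤-reflexive (sym (outerSpeed A h≡))
...   | inj₂ (there ())

first∈outer : ∀ {s w A G} → USec s w A G → ∀ rest → s ∈ A ++ (s + len w) ∷ rest
first∈outer {s} uNil rest = here (sym (ℤ.+-identityʳ s))
first∈outer (uCons _ _ _) rest = here refl

fastestGlider : ∀ {s y G} → IsΓD' s y G →
  Σ Glider (λ γ → γ ∈ G × s ∈ stepsOf γ × ((s + len y) - + 1) ∈ stepsOf γ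
    × ((γ' : Glider) → γ' ∈ G → speed γ' ≤ speed γ))
fastestGlider {s} Γy@d10 =
  _ , here refl , here refl , there (here (ℤ.+-assoc s (+ 2) -[1+ 0 ])) ,
  λ _ → speed≤height-D' Γy
fastestGlider Γy@(dBig {w₁ = w₁} {A = A} {B} {G₁} {G₂} secU _ _ _ h≡) =
  _ , ∈-++⁺ʳ G₁ (∈-++⁺ʳ G₂ (here refl)) , ∈-++⁺ˡ (first∈outer secU _) ,
  ∈-++⁺ʳ (A ++ _ ∷ _ ∷ []) (∈-++⁺ʳ B (here refl)) ,
  λ _ γ'∈G → ≤-trans (speed≤height-D' Γy γ'∈G) (≤-reflexive (outerSpeed A h≡))

length-window : ∀ f i L → length (window f i L) ≡ L
length-window f i zero = refl
length-window f i (suc L) = cong suc (length-window f (i + + 1) L)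

lemma13 : (n k : ℕ) .{{_ : NonZero n}} → 1 ≤ k → 2 * k Data.Nat.+ 1 ≤ n →
    (x : Vec Bool n) → ones x ≡ k →
    (H : ℤ → ℤ) → IsHeight (xhat x) H →
    (i : ℤ) (L : ℕ) → IsD' (window (xhat x) i L) →
    H i ≡ + 0 → H (i + + L) ≡ + 0 →
    (G : List Glider) → IsΓD' i (window (xhat x) i L) G →
    Σ Glider (λ γ → γ ∈ G × i ∈ stepsOf γ × ((i + + L) - + 1) ∈ stepsOf γ
    × ((γ' : Glider) → γ' ∈ G → speed γ' ≤ speed γ))
lemma13 n k _ _ x _ H _ i L _ _ _ G Γy with fastestGlider Γy
... | γ , γ∈G , first∈γ , last∈γ , fastest =
  γ , γ∈G , first∈γ ,
  subst (λ m → ((i + + m) - + 1) ∈ stepsOf γ) (length-window (xhat x) i L) last∈γ , fastest
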